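{- Let $G$ be a finite group of order $v$. If a $(v,k,\lambda)$ difference set exists in $G$, then a $(v,v,v-4n)$ signed difference set exists in $G$, where $n=k-\lambda$.
   Context: Let $G$ be a finite group of order $v$ and $\mathbb{Z}[G]$ its integral group ring; a subset $S\subseteq G$ is identified with $\sum_{g\in S} g\in\mathbb{Z}[G]$, and for $X=\sum a_g g$ write $X^{(-1)}=\sum a_g g^{ -1}$. A $(v,k,\lambda)$ difference set in $G$ is a $k$-subset $D\subseteq G$ with $DD^{(-1)} = n\cdot 1_G+\lambda\sum_{g\in G}g$, where $n=k-\lambda$. A $(v,k,\lambda)$ signed difference set in $G$ is an element $D=\sum_{g\in G}s_g g$ with all $s_g\in\{ -1,0,1\}$ such that, with $P=\{g:s_g=1\}$, $N=\{g:s_g=-1\}$ and $k=\lvert P\rvert+\lvert N\rvert$, one has $DD^{(-1)}=(k-\lambda)\cdot 1_G+\lambda\sum_{g\in G}g$; by convention $\lvert P\rvert\ge\lvert N\rvert$ (replacing $D$ by $-D$ if necessary). -}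

module Defs where

open import Data.Nat using (ℕ; zero; suc)
open import Data.Fin using (Fin; zero; suc; _≟_)
open import Data.Fin.Subset using (Subset; ∣_∣)
open import Data.Vec using (lookup)
open import Data.Integer using (ℤ; +_; -[1+_]; _+_; _-_; _*_; 1ℤ; 0ℤ; -1ℤ)
import Data.Integer as ℤ
open import Data.Bool using (Bool; true; false; if_then_else_)
open import Data.Product using (Σ; _×_; _,_)
open import Data.Sum using (_⊎_)
open import Relation.Nullary.Decidable using (⌊_⌋)
open import Relation.Binary.PropositionalEquality using (_≡_)
open import Algebra.Core using (Op₁; Op₂)
open import Algebra.Structures using (IsGroup)

-- A finite group of order v, with carrier Fin v (every finite group of
-- order v is isomorphic to one of this form) and propositional equality.
record FinGroup (v : ℕ) : Set where
  field
    _∙_     : Op₂ (Fin v)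
    ε       : Fin v
    _⁻¹     : Op₁ (Fin v)
    isGroup : IsGroup _≡_ _∙_ ε _⁻¹

Σℤ : ∀ {n} → (Fin n → ℤ) → ℤ
Σℤ {zero}  f = 0ℤ
Σℤ {suc n} f = f zero + Σℤ (λ i → f (suc i))

count : ∀ {n} → (Fin n → Bool) → ℕ
count {zero}  p = 0
count {suc n} p = (if p zero then 1 else 0) Data.Nat.+ count (λ i → p (suc i))

-- Elements of the integral group ring Z[G], as coefficient functions G → Z.
ZG : ℕ → Set
ZG v = Fin v → ℤ

module _ {v : ℕ} (G : FinGroup v) where
  open FinGroup G

  _⊛_ : ZG v → ZG v → ZG v
  (X ⊛ Y) g = Σℤ (λ h → X h * Y ((h ⁻¹) ∙ g))

  -- X^(-1) = Σ a_g g⁻¹, i.e. coefficient at g is a_{g⁻¹}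
  inv⁽⁻¹⁾ : ZG v → ZG v
  inv⁽⁻¹⁾ X g = X (g ⁻¹)

  -- n·1_G + λ·(Σ_{g∈G} g)
  scalarPlusAll : ℤ → ℤ → ZG v
  scalarPlusAll n lam g = (if ⌊ g ≟ ε ⌋ then n else 0ℤ) + lam

  indicator : Subset v → ZG v
  indicator S g = if lookup S g then 1ℤ else 0ℤ

  IsDiffSet : ℕ → ℕ → Subset v → Set
  IsDiffSet k lam D =
    (∣ D ∣ ≡ k) ×
    (∀ g → (indicator D ⊛ inv⁽⁻¹⁾ (indicator D)) g
             ≡ scalarPlusAll (+ k - + lam) (+ lam) g)

  DiffSetExists : ℕ → ℕ → Set
  DiffSetExists k lam = Σ (Subset v) (IsDiffSet k lam)

  -- D = Σ s_g g is a (v,k,λ) signed difference set in G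
  -- (with P = {s_g = 1}, N = {s_g = -1}, k = |P| + |N|, convention |P| ≥ |N|)
  IsSignedDiffSet : ℕ → ℤ → ZG v → Set
  IsSignedDiffSet k lam D =
    (∀ g → (D g ≡ 1ℤ) ⊎ (D g ≡ 0ℤ) ⊎ (D g ≡ -1ℤ)) ×
    (count (λ g → ⌊ D g ℤ.≟ 1ℤ ⌋) Data.Nat.+ count (λ g → ⌊ D g ℤ.≟ -1ℤ ⌋) ≡ k) ×
    (count (λ g → ⌊ D g ℤ.≟ -1ℤ ⌋) Data.Nat.≤ count (λ g → ⌊ D g ℤ.≟ 1ℤ ⌋)) ×
    (∀ g → (D ⊛ inv⁽⁻¹⁾ D) g ≡ scalarPlusAll (+ k - lam) lam g)

  SignedDiffSetExists : ℕ → ℤ → Set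
  SignedDiffSetExists k lam = Σ (ZG v) (IsSignedDiffSet k lam)

{-# OPTIONS --safe #-}
module Submission where

-- If D is a (v,k,λ) difference set, put E = G − 2D ∈ ℤ[G], whose coefficients are ±1.
-- Since D G = G D⁽⁻¹⁾ = k G and G G = v G,
--   E E⁽⁻¹⁾ = v G − 4k G + 4 D D⁽⁻¹⁾ = 4n · 1 + (v − 4n) G,
-- so E is a signed difference set with k = v and λ = v − 4n; its negative satisfies the
-- same identity, and one of ±E meets the convention |P| ≥ |N|.

open import Defs
open import Data.Nat as ℕ using (ℕ; zero; suc; _≤_; _≤?_)
open import Data.Nat.Properties using (+-comm; +-suc; ≰⇒≥)
open import Data.Integer using (ℤ; +_; -[1+_]; _+_; _-_; _*_; -_; 0ℤ; 1ℤ; -1ℤ)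
import Data.Integer as ℤ
open import Data.Integer.Properties using (+-*-semiring; +-identityˡ; neg-involutive)
open import Data.Integer.Tactic.RingSolver using (solve-∀)
open import Data.Fin using (Fin; zero; suc; _≟_)
open import Data.Fin.Subset using (Subset; ∣_∣)
open import Data.Fin.Permutation using (Permutation; permutation)
open import Data.Vec using ([]; _∷_; lookup)
open import Data.Bool using (Bool; true; false; if_then_else_; not)
open import Data.Product using (_,_)
open import Data.Sum using (_⊎_; inj₁; inj₂)
open import Function using (_∘_)
open import Relation.Nullary using (yes; no)
open import Relation.Nullary.Decidable using (⌊_⌋)
open import Relation.Binary.PropositionalEquality
open import Algebra.Bundles using (Group)
open import Algebra.Properties.Semiring.Sum +-*-semiring
  using (sum; sum-cong-≗; ∑-distrib-+; *-distribˡ-sum; sum-permute)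

Σℤ≡sum : ∀ {n} (f : Fin n → ℤ) → Σℤ f ≡ sum f
Σℤ≡sum {zero}  f = refl
Σℤ≡sum {suc n} f = cong (_+_ (f zero)) (Σℤ≡sum (f ∘ suc))

sum-const-1 : ∀ n → sum {n} (λ _ → 1ℤ) ≡ + n
sum-const-1 zero    = refl
sum-const-1 (suc n) = cong (_+_ 1ℤ) (sum-const-1 n)

sum-if-1-0≡count : ∀ {n} (p : Fin n → Bool) → sum (λ i → if p i then 1ℤ else 0ℤ) ≡ + count p
sum-if-1-0≡count {zero}  p = refl
sum-if-1-0≡count {suc n} p with p zero
... | true  = cong (_+_ 1ℤ) (sum-if-1-0≡count (p ∘ suc))
... | false = trans (+-identityˡ _) (sum-if-1-0≡count (p ∘ suc))

count-cong : ∀ {n} {p q : Fin n → Bool} → (∀ i → p i ≡ q i) → count p ≡ count q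
count-cong {zero}  p≗q = refl
count-cong {suc n} p≗q rewrite p≗q zero = cong (_ ℕ.+_) (count-cong (p≗q ∘ suc))

count+count-not : ∀ {n} (p : Fin n → Bool) → count p ℕ.+ count (not ∘ p) ≡ n
count+count-not {zero}  p = refl
count+count-not {suc n} p with p zero
... | true  = cong suc (count+count-not (p ∘ suc))
... | false = trans (+-suc (count (p ∘ suc)) _) (cong suc (count+count-not (p ∘ suc)))

∣∣≡count-lookup : ∀ {n} (S : Subset n) → ∣ S ∣ ≡ count (lookup S)
∣∣≡count-lookup []          = refl
∣∣≡count-lookup (true ∷ S)  = cong suc (∣∣≡count-lookup S)
∣∣≡count-lookup (false ∷ S) = ∣∣≡count-lookup S

⌊-x≟1⌋≡⌊x≟-1⌋ : ∀ x → ⌊ - x ℤ.≟ 1ℤ ⌋ ≡ ⌊ x ℤ.≟ -1ℤ ⌋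
⌊-x≟1⌋≡⌊x≟-1⌋ (+ zero)      = refl
⌊-x≟1⌋≡⌊x≟-1⌋ (+ suc n)     = refl
⌊-x≟1⌋≡⌊x≟-1⌋ -[1+ zero ]   = refl
⌊-x≟1⌋≡⌊x≟-1⌋ -[1+ suc n ]  = refl

⌊-x≟-1⌋≡⌊x≟1⌋ : ∀ x → ⌊ - x ℤ.≟ -1ℤ ⌋ ≡ ⌊ x ℤ.≟ 1ℤ ⌋
⌊-x≟-1⌋≡⌊x≟1⌋ x = trans (sym (⌊-x≟1⌋≡⌊x≟-1⌋ (- x))) (cong (λ y → ⌊ y ℤ.≟ 1ℤ ⌋) (neg-involutive x))

sum-1+linear : ∀ {n} (p q r : ℤ) (f g e : Fin n → ℤ) →
             sum (λ i → 1ℤ + p * f i + q * g i + r * e i) ≡ + n + p * sum f + q * sum g + r * sum e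
sum-1+linear {n} p q r f g e = begin
  sum (λ i → 1ℤ + p * f i + q * g i + r * e i)
    ≡⟨ ∑-distrib-+ (λ i → 1ℤ + p * f i + q * g i) (λ i → r * e i) ⟩
  sum (λ i → 1ℤ + p * f i + q * g i) + sum (λ i → r * e i)
    ≡⟨ cong (λ s → s + sum (λ i → r * e i)) (∑-distrib-+ (λ i → 1ℤ + p * f i) (λ i → q * g i)) ⟩
  sum (λ i → 1ℤ + p * f i) + sum (λ i → q * g i) + sum (λ i → r * e i)
    ≡⟨ cong (λ s → s + sum (λ i → q * g i) + sum (λ i → r * e i)) (∑-distrib-+ (λ _ → 1ℤ) (λ i → p * f i)) ⟩
  sum {n} (λ _ → 1ℤ) + sum (λ i → p * f i) + sum (λ i → q * g i) + sum (λ i → r * e i)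
    ≡⟨ cong₂ _+_ (cong₂ _+_ (cong₂ _+_ (sum-const-1 n) (sym (*-distribˡ-sum p f)))
                            (sym (*-distribˡ-sum q g)))
                 (sym (*-distribˡ-sum r e)) ⟩
  + n + p * sum f + q * sum g + r * sum e ∎
  where open ≡-Reasoning

1-2·_ : ∀ {v} → ZG v → ZG v
(1-2· Y) g = 1ℤ - + 2 * Y g

negate : ∀ {v} → ZG v → ZG v
negate X g = - X g

positives negatives : ∀ {v} → ZG v → Fin v → Bool
positives X g = ⌊ X g ℤ.≟ 1ℤ ⌋
negatives X g = ⌊ X g ℤ.≟ -1ℤ ⌋

neg-trichotomy : ∀ {x} → x ≡ 1ℤ ⊎ x ≡ 0ℤ ⊎ x ≡ -1ℤ → - x ≡ 1ℤ ⊎ - x ≡ 0ℤ ⊎ - x ≡ -1ℤ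
neg-trichotomy (inj₁ refl)        = inj₂ (inj₂ refl)
neg-trichotomy (inj₂ (inj₁ refl)) = inj₂ (inj₁ refl)
neg-trichotomy (inj₂ (inj₂ refl)) = inj₁ refl

module _ {v : ℕ} (G : FinGroup v) where
  open FinGroup G

  group : Group _ _
  group = record { isGroup = isGroup }

  open import Algebra.Properties.Group group
    using (\\-leftDividesˡ; \\-leftDividesʳ; ⁻¹-anti-homo-\\)

  infixl 7 _·_
  infix 8 _⁽⁻¹⁾

  _·_ : ZG v → ZG v → ZG v
  _·_ = _⊛_ G

  _⁽⁻¹⁾ : ZG v → ZG v
  _⁽⁻¹⁾ = inv⁽⁻¹⁾ G

  leftMultiplication : Fin v → Permutation v v
  leftMultiplication g = permutation (g ∙_) (λ h → (g ⁻¹) ∙ h) (\\-leftDividesˡ g) (\\-leftDividesʳ g)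

  sum-translate : ∀ (X : ZG v) g → sum (λ h → X (((h ⁻¹) ∙ g) ⁻¹)) ≡ sum X
  sum-translate X g = begin
    sum (λ h → X (((h ⁻¹) ∙ g) ⁻¹)) ≡⟨ sum-cong-≗ (λ h → cong X (⁻¹-anti-homo-\\ h g)) ⟩
    sum (λ h → X ((g ⁻¹) ∙ h))      ≡⟨ sum-permute X (leftMultiplication (g ⁻¹)) ⟨
    sum X                           ∎
    where open ≡-Reasoning

  ·⁽⁻¹⁾-1-2· : ∀ (Y : ZG v) g →
               ((1-2· Y) · (1-2· Y) ⁽⁻¹⁾) g ≡ + v - + 4 * sum Y + + 4 * (Y · Y ⁽⁻¹⁾) g
  ·⁽⁻¹⁾-1-2· Y g = begin
    ((1-2· Y) · (1-2· Y) ⁽⁻¹⁾) g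
      ≡⟨ Σℤ≡sum {v} _ ⟩
    sum (λ h → (1ℤ - + 2 * Y h) * (1ℤ - + 2 * Y′ h))
      ≡⟨ sum-cong-≗ (λ h → expand (Y h) (Y′ h)) ⟩
    sum (λ h → 1ℤ + - + 2 * Y h + - + 2 * Y′ h + + 4 * (Y h * Y′ h))
      ≡⟨ sum-1+linear (- + 2) (- + 2) (+ 4) Y Y′ (λ h → Y h * Y′ h) ⟩
    + v + - + 2 * sum Y + - + 2 * sum Y′ + + 4 * sum (λ h → Y h * Y′ h)
      ≡⟨ cong₂ (λ s c → + v + - + 2 * sum Y + - + 2 * s + + 4 * c)
               (sum-translate Y g) (sym (Σℤ≡sum {v} _)) ⟩
    + v + - + 2 * sum Y + - + 2 * sum Y + + 4 * (Y · Y ⁽⁻¹⁾) g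
      ≡⟨ collect (+ v) (sum Y) _ ⟩
    + v - + 4 * sum Y + + 4 * (Y · Y ⁽⁻¹⁾) g ∎
    where
    open ≡-Reasoning
    Y′ : ZG v
    Y′ h = Y (((h ⁻¹) ∙ g) ⁻¹)
    expand : ∀ a b → (1ℤ - + 2 * a) * (1ℤ - + 2 * b) ≡ 1ℤ + - + 2 * a + - + 2 * b + + 4 * (a * b)
    expand = solve-∀
    collect : ∀ n s c → n + - + 2 * s + - + 2 * s + + 4 * c ≡ n - + 4 * s + + 4 * c
    collect = solve-∀

  ·⁽⁻¹⁾-negate : ∀ (X : ZG v) g → (negate X · negate X ⁽⁻¹⁾) g ≡ (X · X ⁽⁻¹⁾) g
  ·⁽⁻¹⁾-negate X g = begin
    (negate X · negate X ⁽⁻¹⁾) g               ≡⟨ Σℤ≡sum {v} _ ⟩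
    sum (λ h → - X h * - X (((h ⁻¹) ∙ g) ⁻¹))  ≡⟨ sum-cong-≗ (λ h → -a*-b≡a*b (X h) _) ⟩
    sum (λ h → X h * X (((h ⁻¹) ∙ g) ⁻¹))      ≡⟨ Σℤ≡sum {v} _ ⟨
    (X · X ⁽⁻¹⁾) g                             ∎
    where
    open ≡-Reasoning
    -a*-b≡a*b : ∀ a b → - a * - b ≡ a * b
    -a*-b≡a*b = solve-∀

  scalarPlusAll-affine : ∀ a b n lam g →
                         a + b * scalarPlusAll G n lam g ≡ scalarPlusAll G (b * n) (a + b * lam) g
  scalarPlusAll-affine a b n lam g with ⌊ g ≟ ε ⌋
  ... | true  = at-identity a b n lam
    where
    at-identity : ∀ a b n l → a + b * (n + l) ≡ b * n + (a + b * l)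
    at-identity = solve-∀
  ... | false = elsewhere a b lam
    where
    elsewhere : ∀ a b l → a + b * (0ℤ + l) ≡ 0ℤ + (a + b * l)
    elsewhere = solve-∀

  signedDiffSetExists-up-to-sign : ∀ {k lam} (X : ZG v) →
    (∀ g → X g ≡ 1ℤ ⊎ X g ≡ 0ℤ ⊎ X g ≡ -1ℤ) →
    count (positives X) ℕ.+ count (negatives X) ≡ k →
    (∀ g → (X · X ⁽⁻¹⁾) g ≡ scalarPlusAll G (+ k - lam) lam g) →
    SignedDiffSetExists G k lam
  signedDiffSetExists-up-to-sign X X-ternary |P|+|N|≡k XX⁻¹
    with count (negatives X) ≤? count (positives X)
  ... | yes |N|≤|P| = X , X-ternary , |P|+|N|≡k , |N|≤|P| , XX⁻¹
  ... | no  |N|≰|P| =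
    negate X ,
    neg-trichotomy ∘ X-ternary ,
    trans (cong₂ ℕ._+_ |P-X|≡|N| |N-X|≡|P|) (trans (+-comm (count (negatives X)) _) |P|+|N|≡k) ,
    subst₂ _≤_ (sym |N-X|≡|P|) (sym |P-X|≡|N|) (≰⇒≥ |N|≰|P|) ,
    (λ g → trans (·⁽⁻¹⁾-negate X g) (XX⁻¹ g))
    where
    |P-X|≡|N| : count (positives (negate X)) ≡ count (negatives X)
    |P-X|≡|N| = count-cong (⌊-x≟1⌋≡⌊x≟-1⌋ ∘ X)
    |N-X|≡|P| : count (negatives (negate X)) ≡ count (positives X)
    |N-X|≡|P| = count-cong (⌊-x≟-1⌋≡⌊x≟1⌋ ∘ X)

  1-2·indicator-ternary : ∀ (D : Subset v) g →
    let E = 1-2· indicator G D in E g ≡ 1ℤ ⊎ E g ≡ 0ℤ ⊎ E g ≡ -1ℤ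
  1-2·indicator-ternary D g with lookup D g
  ... | true  = inj₂ (inj₂ refl)
  ... | false = inj₁ refl

  count-positives+negatives-1-2·indicator : ∀ (D : Subset v) →
    let E = 1-2· indicator G D in count (positives E) ℕ.+ count (negatives E) ≡ v
  count-positives+negatives-1-2·indicator D = begin
    count (positives E) ℕ.+ count (negatives E)
      ≡⟨ cong₂ ℕ._+_ (count-cong positive≡outside) (count-cong negative≡inside) ⟩
    count (not ∘ lookup D) ℕ.+ count (lookup D) ≡⟨ +-comm (count (not ∘ lookup D)) _ ⟩
    count (lookup D) ℕ.+ count (not ∘ lookup D) ≡⟨ count+count-not (lookup D) ⟩
    v                                           ∎
    where
    open ≡-Reasoning
    E : ZG v
    E = 1-2· indicator G D
    positive≡outside : ∀ g → positives E g ≡ not (lookup D g)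
    positive≡outside g with lookup D g
    ... | true  = refl
    ... | false = refl
    negative≡inside : ∀ g → negatives E g ≡ lookup D g
    negative≡inside g with lookup D g
    ... | true  = refl
    ... | false = refl

  ·⁽⁻¹⁾-1-2·diffSet : ∀ {k lam} (D : Subset v) → IsDiffSet G k lam D → ∀ g →
    let E = 1-2· indicator G D; n = + k - + lam in
    (E · E ⁽⁻¹⁾) g ≡ scalarPlusAll G (+ v - (+ v - + 4 * n)) (+ v - + 4 * n) g
  ·⁽⁻¹⁾-1-2·diffSet {k} {lam} D (|D|≡k , χχ⁻¹) g = begin
    ((1-2· χ) · (1-2· χ) ⁽⁻¹⁾) g
      ≡⟨ ·⁽⁻¹⁾-1-2· χ g ⟩
    + v - + 4 * sum χ + + 4 * (χ · χ ⁽⁻¹⁾) g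
      ≡⟨ cong₂ (λ s c → + v - + 4 * s + + 4 * c) sum-χ (χχ⁻¹ g) ⟩
    + v - + 4 * + k + + 4 * scalarPlusAll G (+ k - + lam) (+ lam) g
      ≡⟨ scalarPlusAll-affine (+ v - + 4 * + k) (+ 4) (+ k - + lam) (+ lam) g ⟩
    scalarPlusAll G (+ 4 * (+ k - + lam)) (+ v - + 4 * + k + + 4 * + lam) g
      ≡⟨ cong₂ (λ a b → scalarPlusAll G a b g)
               (identity-part (+ v) (+ k) (+ lam)) (all-part (+ v) (+ k) (+ lam)) ⟩
    scalarPlusAll G (+ v - (+ v - + 4 * (+ k - + lam))) (+ v - + 4 * (+ k - + lam)) g ∎
    where
    open ≡-Reasoning
    χ : ZG v
    χ = indicator G D
    sum-χ : sum χ ≡ + k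
    sum-χ = trans (sum-if-1-0≡count (lookup D)) (cong +_ (trans (sym (∣∣≡count-lookup D)) |D|≡k))
    identity-part : ∀ v k l → + 4 * (k - l) ≡ v - (v - + 4 * (k - l))
    identity-part = solve-∀
    all-part : ∀ v k l → v - + 4 * k + + 4 * l ≡ v - + 4 * (k - l)
    all-part = solve-∀

proposition2 : ∀ {v : ℕ} (G : FinGroup v) (k lam : ℕ) →
    DiffSetExists G k lam →
    SignedDiffSetExists G v (+ v - + 4 * (+ k - + lam))
proposition2 G k lam (D , isD) =
  signedDiffSetExists-up-to-sign G (1-2· indicator G D)
    (1-2·indicator-ternary G D)
    (count-positives+negatives-1-2·indicator G D)
    (·⁽⁻¹⁾-1-2·diffSet G D isD)
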